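{- Let $G=(V,E)$ be a finite simple graph of diameter at most $2$, with vertex set $V=\{v_1,\ldots,v_n\}$ and edge set $E=\{e_1,\ldots,e_m\}$. For every pair of vertices $v_i,v_j$ with $i<j$ define the path polynomial $P_{i,j}\in\mathbb{Q}[x_1,\ldots,x_m]$ by $P_{i,j}=1$ if $v_i$ and $v_j$ are adjacent, and otherwise $$P_{i,j}=\sum_{e_a,e_b\in E:\ v_i-e_a-e_b-v_j \text{ is a path in } G}(x_a-x_b)^2 ,$$ and let $f_G=\prod_{1\le i<j\le n}P_{i,j}$. Let $V_{m,3}\subseteq\mathbb{Q}^m$ be the set of points whose coordinates take at most $2$ distinct values, and let $I_{m,3}\subseteq\mathbb{Q}[x_1,\ldots,x_m]$ be the ideal of all polynomials vanishing at every point of $V_{m,3}$. Then $f_G\in I_{m,3}$ if and only if $rc(G)\ge 3$.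
   Context: A path $v_i-e_a-e_b-v_j$ means that $e_a=(v_i,w)$ and $e_b=(w,v_j)$ are edges of $G$ for some vertex $w$, i.e. a path of length two from $v_i$ to $v_j$ through edges $e_a,e_b$. In an edge-colored graph, a rainbow path is a path whose edges all have distinct colors; $G$ is rainbow connected if every two vertices are joined by a rainbow path. The rainbow connection number $rc(G)$ is the least number of colors in an edge coloring of $G$ making $G$ rainbow connected. -}

module Defs where

open import Data.Nat using (ℕ; _<_)
open import Data.Fin using (Fin) renaming (_<_ to _<ᶠ_)
open import Data.Fin.Properties using (any?) renaming (_≟_ to _≟ᶠ_; _<?_ to _<ᶠ?_)
open import Data.Product using (Σ; ∃; ∃-syntax; _×_; _,_; proj₁; proj₂; swap)
open import Data.Product.Properties using (≡-dec)
open import Data.Sum using (_⊎_; inj₁; inj₂)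
open import Data.Sum.Relation.Unary.All using () 
open import Data.List using (List; []; _∷_; map; filter; cartesianProduct; foldr)
open import Data.Fin.Base using () 
open import Data.List.Base using ()
open import Data.List.Relation.Unary.Unique.Propositional using (Unique)
open import Data.Rational using (ℚ; 0ℚ; 1ℚ; _+_; _*_; -_)
open import Relation.Binary.PropositionalEquality using (_≡_; _≢_)
open import Relation.Nullary using (¬_; Dec; yes; no)
open import Relation.Nullary.Decidable using (_⊎-dec_; _×-dec_)
import Data.List as L

record Graph (n m : ℕ) : Set where
  field
    ends     : Fin m → Fin n × Fin n
    loopless : ∀ a → proj₁ (ends a) ≢ proj₂ (ends a)
    simple   : ∀ a b → (ends a ≡ ends b ⊎ ends a ≡ swap (ends b)) → a ≡ b

module _ {n m : ℕ} (G : Graph n m) where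
  open Graph G

  Joins : Fin m → Fin n → Fin n → Set
  Joins a u w = ends a ≡ (u , w) ⊎ ends a ≡ (w , u)

  joins? : ∀ a u w → Dec (Joins a u w)
  joins? a u w = ≡-dec _≟ᶠ_ _≟ᶠ_ (ends a) (u , w) ⊎-dec ≡-dec _≟ᶠ_ _≟ᶠ_ (ends a) (w , u)

  Adj : Fin n → Fin n → Set
  Adj u v = ∃[ a ] Joins a u v

  adj? : ∀ u v → Dec (Adj u v)
  adj? u v = any? (λ a → joins? a u v)

  DiamAtMost2 : Set
  DiamAtMost2 = ∀ u v → u ≢ v → Adj u v ⊎ (∃[ w ] (Adj u w × Adj w v))

  data Walk : Fin n → Fin n → Set where
    []   : ∀ {u} → Walk u u
    step : ∀ {u w v} (a : Fin m) → Joins a u w → Walk w v → Walk u v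

  edgesOf : ∀ {u v} → Walk u v → List (Fin m)
  edgesOf []           = []
  edgesOf (step a _ p) = a ∷ edgesOf p

  verticesOf : ∀ {u v} → Walk u v → List (Fin n)
  verticesOf {u} []           = u ∷ []
  verticesOf {u} (step a _ p) = u ∷ verticesOf p

  IsPath : ∀ {u v} → Walk u v → Set
  IsPath p = Unique (verticesOf p)

  IsRainbow : ∀ {k u v} → (Fin m → Fin k) → Walk u v → Set
  IsRainbow c p = Unique (map c (edgesOf p))

  RainbowConnected : ∀ {k} → (Fin m → Fin k) → Set
  RainbowConnected c = ∀ u v → Σ (Walk u v) λ p → IsPath p × IsRainbow c p

  -- rc(G) ≥ t : no edge colouring with fewer than t colours makes G
  -- rainbow connected (rc(G) is the least such number of colours).
  RCAtLeast : ℕ → Set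
  RCAtLeast t = ∀ k → k < t → (c : Fin m → Fin k) → ¬ RainbowConnected c

data Poly (m : ℕ) : Set where
  var   : Fin m → Poly m
  const : ℚ → Poly m
  _⊕_   : Poly m → Poly m → Poly m
  _⊗_   : Poly m → Poly m → Poly m
  ⊖_    : Poly m → Poly m

eval : ∀ {m} → (Fin m → ℚ) → Poly m → ℚ
eval x (var a)   = x a
eval x (const q) = q
eval x (p ⊕ q)   = eval x p + eval x q
eval x (p ⊗ q)   = eval x p * eval x q
eval x (⊖ p)     = - eval x p

sumP : ∀ {m} → List (Poly m) → Poly m
sumP = foldr _⊕_ (const 0ℚ)

prodP : ∀ {m} → List (Poly m) → Poly m
prodP = foldr _⊗_ (const 1ℚ)

allFin : (k : ℕ) → List (Fin k)
allFin k = L.allFin k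

module _ {n m : ℕ} (G : Graph n m) where

  Path2 : Fin n → Fin n → Fin m × Fin m → Set
  Path2 i j (a , b) = ∃[ w ] (Joins G a i w × Joins G b w j)

  path2? : ∀ i j ab → Dec (Path2 i j ab)
  path2? i j (a , b) = any? (λ w → joins? G a i w ×-dec joins? G b w j)

  sqDiff : Fin m × Fin m → Poly m
  sqDiff (a , b) = (var a ⊕ (⊖ var b)) ⊗ (var a ⊕ (⊖ var b))

  pathPoly : Fin n → Fin n → Poly m
  pathPoly i j with adj? G i j
  ... | yes _ = const 1ℚ
  ... | no  _ = sumP (map sqDiff (filter (path2? i j)
                                     (cartesianProduct (allFin m) (allFin m))))

  orderedPairs : List (Fin n × Fin n)
  orderedPairs = filter (λ ij → proj₁ ij <ᶠ? proj₂ ij)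
                        (cartesianProduct (allFin n) (allFin n))

  fG : Poly m
  fG = prodP (map (λ ij → pathPoly (proj₁ ij) (proj₂ ij)) orderedPairs)

InV[_,3] : (m : ℕ) → (Fin m → ℚ) → Set
InV[ m ,3] x = ∃[ y ] ∃[ z ] (∀ a → x a ≡ y ⊎ x a ≡ z)

InI[_,3] : (m : ℕ) → Poly m → Set
InI[ m ,3] f = ∀ x → InV[ m ,3] x → eval x f ≡ 0ℚ

module Submission where

-- Say that a map f from the edges to some set makes G "rainbow in two steps"
-- when any two distinct vertices are adjacent or are joined by a path
-- v_i - e_a - e_b - v_j with f(e_a) ≠ f(e_b).  The proof rests on three facts.
--
--  (1) For a point x ∈ ℚ^m, f_G(x) ≠ 0 iff x makes G rainbow in two steps:
--      a product over ℚ vanishes iff a factor does, and a sum of squares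
--      vanishes iff every square does, i.e. iff x_a = x_b on every 2-path.
--  (2) For an edge colouring c with two colours, c makes G rainbow connected
--      iff c makes G rainbow in two steps: a rainbow path has at most two
--      edges, since three distinct colours cannot occur among two.
--  (3) Points of V_{m,3} and 2-colourings correspond to each other: a point
--      taking the values y, z yields the colouring "x_a = y or not", and a
--      2-colouring yields the point with coordinates 0 and 1; both
--      translations keep distinct values distinct.
--
-- Hence a 2-colouring rainbow connecting G gives a point of V_{m,3} outside the
-- zero set of f_G and conversely; a colouring with fewer than three colours is
-- a 2-colouring after renaming colours.

open import Defs
open import Data.Nat using (ℕ) renaming (_≤_ to _≤ℕ_)
import Data.Nat.Properties as ℕP
open import Data.Fin using (Fin; zero; suc; inject≤) renaming (_<_ to _<ᶠ_)
import Data.Fin.Properties as FinP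
open import Data.Product using (Σ; _×_; _,_; proj₁; proj₂)
open import Data.Sum using (_⊎_; inj₁; inj₂)
import Data.Sum as Sum
open import Data.Empty using (⊥; ⊥-elim)
open import Data.List using (List; []; _∷_; map; filter; cartesianProduct)
open import Data.List.Properties using (map-∘)
open import Data.List.Relation.Unary.All using (All; []; _∷_)
import Data.List.Relation.Unary.All as All
import Data.List.Relation.Unary.All.Properties as AllP
open import Data.List.Relation.Unary.Any using (Any; here; there)
import Data.List.Relation.Unary.Any as Any
import Data.List.Relation.Unary.Any.Properties as AnyP
open import Data.List.Relation.Unary.AllPairs using ([]; _∷_)
open import Data.List.Relation.Unary.Unique.Propositional using (Unique)
import Data.List.Relation.Unary.Unique.Propositional.Properties as UniqueP
open import Data.List.Membership.Propositional using (find; lose)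
open import Data.List.Membership.Propositional.Properties
  using (∈-filter⁻; ∈-filter⁺; ∈-cartesianProduct⁺; ∈-allFin)
open import Data.Rational using (ℚ; 0ℚ; 1ℚ; _+_; _*_; -_; _≤_; _<_; 1/_; ≢-nonZero; negative; positive)
import Data.Rational.Properties as ℚP
open import Algebra.Properties.Group ℚP.+-0-group using (x∙y⁻¹≈ε⇒x≈y; x≈y⇒x∙y⁻¹≈ε)
open import Function using (_∘_)
open import Function.Bundles using (_⇔_; mk⇔; Equivalence)
open import Relation.Binary.PropositionalEquality
open import Relation.Binary.Definitions using (tri<; tri≈; tri>)
open import Relation.Nullary using (Dec; yes; no; contradiction)

open Equivalence using (to; from)

zero-product : ∀ p q → p * q ≡ 0ℚ → p ≡ 0ℚ ⊎ q ≡ 0ℚ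
zero-product p q pq≡0 with p ℚP.≟ 0ℚ
... | yes p≡0 = inj₁ p≡0
... | no  p≢0 = inj₂ (begin
    q              ≡⟨ ℚP.*-identityˡ q ⟨
    1ℚ * q         ≡⟨ cong (_* q) (ℚP.*-inverseˡ p {{p≠0}}) ⟨
    (p⁻¹ * p) * q  ≡⟨ ℚP.*-assoc p⁻¹ p q ⟩
    p⁻¹ * (p * q)  ≡⟨ cong (p⁻¹ *_) pq≡0 ⟩
    p⁻¹ * 0ℚ       ≡⟨ ℚP.*-zeroʳ p⁻¹ ⟩
    0ℚ             ∎)
  where
  open ≡-Reasoning
  p≠0 = ≢-nonZero p≢0
  p⁻¹ = (1/ p) {{p≠0}}

square-pos : ∀ p → p ≢ 0ℚ → 0ℚ < p * p
square-pos p p≢0 with ℚP.<-cmp p 0ℚ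
... | tri< p<0 _ _ = ℚP.positive⁻¹ (p * p) {{ℚP.neg*neg⇒pos p {{negative p<0}} p {{negative p<0}}}}
... | tri≈ _ p≡0 _ = contradiction p≡0 p≢0
... | tri> _ _ p>0 = ℚP.positive⁻¹ (p * p) {{ℚP.pos*pos⇒pos p {{positive p>0}} p {{positive p>0}}}}

square-nonneg : ∀ p → 0ℚ ≤ p * p
square-nonneg p with p ℚP.≟ 0ℚ
... | yes refl = ℚP.≤-refl
... | no  p≢0  = ℚP.<⇒≤ (square-pos p p≢0)

module _ {m : ℕ} (x : Fin m → ℚ) where

  prodP-nonzero⇔ : ∀ ps → eval x (prodP ps) ≢ 0ℚ ⇔ All (λ p → eval x p ≢ 0ℚ) ps
  prodP-nonzero⇔ ps = mk⇔ (forward ps) (backward ps)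
    where
    forward : ∀ ps → eval x (prodP ps) ≢ 0ℚ → All (λ p → eval x p ≢ 0ℚ) ps
    forward []       _  = []
    forward (p ∷ ps) ≢0 =
      (λ p≡0 → ≢0 (trans (cong (_* rest) p≡0) (ℚP.*-zeroˡ rest))) ∷
      forward ps (λ ps≡0 → ≢0 (trans (cong (eval x p *_) ps≡0) (ℚP.*-zeroʳ (eval x p))))
      where rest = eval x (prodP ps)

    backward : ∀ ps → All (λ p → eval x p ≢ 0ℚ) ps → eval x (prodP ps) ≢ 0ℚ
    backward []       []           ()
    backward (p ∷ ps) (p≢0 ∷ ps≢0) ≡0 =
      Sum.[ p≢0 , backward ps ps≢0 ] (zero-product _ _ ≡0)

  sumP-nonzero : ∀ ts → eval x (sumP ts) ≢ 0ℚ → Any (λ t → eval x t ≢ 0ℚ) ts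
  sumP-nonzero []       ≢0 = ⊥-elim (≢0 refl)
  sumP-nonzero (t ∷ ts) ≢0 with eval x t ℚP.≟ 0ℚ
  ... | no  t≢0 = here t≢0
  ... | yes t≡0 = there (sumP-nonzero ts (λ ts≡0 → ≢0 (cong₂ _+_ t≡0 ts≡0)))

  sumP-nonneg : ∀ ts → All (λ t → 0ℚ ≤ eval x t) ts → 0ℚ ≤ eval x (sumP ts)
  sumP-nonneg []       []       = ℚP.≤-refl
  sumP-nonneg (t ∷ ts) (t≥0 ∷ ts≥0) = ℚP.+-mono-≤ t≥0 (sumP-nonneg ts ts≥0)

  sumP-pos : ∀ ts → All (λ t → 0ℚ ≤ eval x t) ts → Any (λ t → 0ℚ < eval x t) ts →
             0ℚ < eval x (sumP ts)
  sumP-pos (t ∷ ts) (_ ∷ ts≥0) (here t>0)  = ℚP.+-mono-<-≤ t>0 (sumP-nonneg ts ts≥0)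
  sumP-pos (t ∷ ts) (t≥0 ∷ ts≥0) (there p) = ℚP.+-mono-≤-< t≥0 (sumP-pos ts ts≥0 p)

noThreeDistinct : (p q r : Fin 2) → p ≢ q → p ≢ r → q ≢ r → ⊥
noThreeDistinct zero       zero       _          p≢q _   _   = p≢q refl
noThreeDistinct zero       (suc zero) zero       _   p≢r _   = p≢r refl
noThreeDistinct zero       (suc zero) (suc zero) _   _   q≢r = q≢r refl
noThreeDistinct (suc zero) zero       zero       _   _   q≢r = q≢r refl
noThreeDistinct (suc zero) zero       (suc zero) _   p≢r _   = p≢r refl
noThreeDistinct (suc zero) (suc zero) _          p≢q _   _   = p≢q refl

module _ {n m : ℕ} (G : Graph n m) where

  joins-irrefl : ∀ {a u w} → Joins G a u w → u ≢ w
  joins-irrefl {a} (inj₁ e) u≡w = subst (λ p → proj₁ p ≢ proj₂ p) e (Graph.loopless G a) u≡w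
  joins-irrefl {a} (inj₂ e) u≡w = subst (λ p → proj₁ p ≢ proj₂ p) e (Graph.loopless G a) (sym u≡w)

  RainbowPath2 : {A : Set} → (Fin m → A) → Fin n → Fin n → Set
  RainbowPath2 f i j = Σ (Fin m × Fin m) λ ab → Path2 G i j ab × f (proj₁ ab) ≢ f (proj₂ ab)

  Linked : {A : Set} → (Fin m → A) → Fin n → Fin n → Set
  Linked f i j = Adj G i j ⊎ RainbowPath2 f i j

  TwoStepRainbow : {A : Set} → (Fin m → A) → Set
  TwoStepRainbow f = ∀ u v → u ≢ v → Linked f u v

  Linked-sym : ∀ {A : Set} {f : Fin m → A} {i j} → Linked f i j → Linked f j i
  Linked-sym (inj₁ (a , J))                   = inj₁ (a , Sum.swap J)
  Linked-sym (inj₂ ((a , b) , (w , J , J′) , fa≢fb)) =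
    inj₂ ((b , a) , (w , Sum.swap J′ , Sum.swap J) , fa≢fb ∘ sym)

  TwoStepRainbow-map : ∀ {A B : Set} {f : Fin m → A} {g : Fin m → B} →
                       (∀ {a b} → f a ≢ f b → g a ≢ g b) →
                       TwoStepRainbow f → TwoStepRainbow g
  TwoStepRainbow-map keep two u v u≢v with two u v u≢v
  ... | inj₁ adj                 = inj₁ adj
  ... | inj₂ (ab , path , f≢)    = inj₂ (ab , path , keep f≢)

  module _ (x : Fin m → ℚ) where

    sqDiff-nonzero⇔ : ∀ ab → eval x (sqDiff G ab) ≢ 0ℚ ⇔ x (proj₁ ab) ≢ x (proj₂ ab)
    sqDiff-nonzero⇔ (a , b) = mk⇔
      (λ ≢0 xa≡xb → ≢0 (trans (cong (λ d → d * d) (x≈y⇒x∙y⁻¹≈ε xa≡xb)) (ℚP.*-zeroˡ 0ℚ)))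
      (λ xa≢xb ≡0 → ℚP.<-irrefl (sym ≡0) (square-pos _ (xa≢xb ∘ x∙y⁻¹≈ε⇒x≈y (x a) (x b))))

    sumSquares-nonzero⇔ : ∀ abs →
      eval x (sumP (map (sqDiff G) abs)) ≢ 0ℚ ⇔ Any (λ ab → x (proj₁ ab) ≢ x (proj₂ ab)) abs
    sumSquares-nonzero⇔ abs = mk⇔
      (λ ≢0 → Any.map (to (sqDiff-nonzero⇔ _)) (AnyP.map⁻ (sumP-nonzero x _ ≢0)))
      (λ any ≡0 → ℚP.<-irrefl (sym ≡0) (sumP-pos x _
          (AllP.map⁺ (All.tabulate λ {(a , b)} _ → square-nonneg (x a + - x b)))
          (AnyP.map⁺ (Any.map (λ {(a , b)} xa≢xb →
             square-pos _ (xa≢xb ∘ x∙y⁻¹≈ε⇒x≈y (x a) (x b))) any))))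

    anyPath2⇔ : ∀ i j → Any (λ ab → x (proj₁ ab) ≢ x (proj₂ ab))
                          (filter (path2? G i j) (cartesianProduct (allFin m) (allFin m)))
                        ⇔ RainbowPath2 x i j
    anyPath2⇔ i j = mk⇔
      (λ any → let (ab , mem , x≢) = find any
               in ab , proj₂ (∈-filter⁻ (path2? G i j) {xs = cartesianProduct (allFin m) (allFin m)} mem) , x≢)
      (λ { ((a , b) , path , x≢) →
             lose (∈-filter⁺ (path2? G i j) (∈-cartesianProduct⁺ (∈-allFin a) (∈-allFin b)) path) x≢ })

    pathPoly-nonzero⇔ : ∀ i j → eval x (pathPoly G i j) ≢ 0ℚ ⇔ Linked x i j
    pathPoly-nonzero⇔ i j with adj? G i j
    ... | yes adj = mk⇔ (λ _ → inj₁ adj) (λ _ ())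
    ... | no ¬adj = mk⇔
      (inj₂ ∘ to (anyPath2⇔ i j) ∘ to (sumSquares-nonzero⇔ _))
      Sum.[ (λ adj → contradiction adj ¬adj) , from (sumSquares-nonzero⇔ _) ∘ from (anyPath2⇔ i j) ]

    fG-nonzero⇔ : eval x (fG G) ≢ 0ℚ ⇔ (∀ i j → i <ᶠ j → eval x (pathPoly G i j) ≢ 0ℚ)
    fG-nonzero⇔ = mk⇔
      (λ ≢0 i j i<j → All.lookup (AllP.map⁻ (to (prodP-nonzero⇔ x _) ≢0))
                        (∈-filter⁺ ordered? (∈-cartesianProduct⁺ (∈-allFin i) (∈-allFin j)) i<j))
      (λ ≢0 → from (prodP-nonzero⇔ x _) (AllP.map⁺ (All.tabulate {P = FactorNonzero}
                λ {(i , j)} mem → ≢0 i j (proj₂ (∈-filter⁻ ordered? {xs = pairs} mem)))))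
      where
      pairs : List (Fin n × Fin n)
      pairs = cartesianProduct (allFin n) (allFin n)
      ordered? : (ij : Fin n × Fin n) → Dec (proj₁ ij <ᶠ proj₂ ij)
      ordered? ij = proj₁ ij FinP.<? proj₂ ij
      FactorNonzero : Fin n × Fin n → Set
      FactorNonzero (i , j) = eval x (pathPoly G i j) ≢ 0ℚ

    fG-nonzero⇔twoStep : eval x (fG G) ≢ 0ℚ ⇔ TwoStepRainbow x
    fG-nonzero⇔twoStep = mk⇔
      (λ ≢0 u v u≢v → linked (to fG-nonzero⇔ ≢0) u v u≢v)
      (λ two → from fG-nonzero⇔ λ i j i<j → from (pathPoly-nonzero⇔ i j) (two i j (FinP.<⇒≢ i<j)))
      where
      linked : (∀ i j → i <ᶠ j → eval x (pathPoly G i j) ≢ 0ℚ) → TwoStepRainbow x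
      linked ordered u v u≢v with FinP.<-cmp u v
      ... | tri< u<v _ _ = to (pathPoly-nonzero⇔ u v) (ordered u v u<v)
      ... | tri≈ _ u≡v _ = contradiction u≡v u≢v
      ... | tri> _ _ v<u = Linked-sym (to (pathPoly-nonzero⇔ v u) (ordered v u v<u))

  twoStep⇒rainbowConnected : ∀ {k} (c : Fin m → Fin k) → TwoStepRainbow c → RainbowConnected G c
  twoStep⇒rainbowConnected c two u v with u FinP.≟ v
  ... | yes refl = [] , ([] ∷ []) , []
  ... | no u≢v with two u v u≢v
  ...   | inj₁ (a , J) = step a J [] , ((u≢v ∷ []) ∷ [] ∷ []) , ([] ∷ [])
  ...   | inj₂ ((a , b) , (w , J , J′) , ca≢cb) =
    step a J (step b J′ []) ,
    ((joins-irrefl J ∷ u≢v ∷ []) ∷ (joins-irrefl J′ ∷ []) ∷ [] ∷ []) ,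
    ((ca≢cb ∷ []) ∷ [] ∷ [])

  shortRainbow : (c : Fin m → Fin 2) → ∀ {u v} (p : Walk G u v) → u ≢ v →
                 IsRainbow G c p → Linked c u v
  shortRainbow c []                            u≢u _ = contradiction refl u≢u
  shortRainbow c (step a J [])                 _   _ = inj₁ (a , J)
  shortRainbow c (step a J (step b J′ []))     _   ((ca≢cb ∷ _) ∷ _) =
    inj₂ ((a , b) , (_ , J , J′) , ca≢cb)
  shortRainbow c (step a _ (step b _ (step d _ _))) _ ((ca≢cb ∷ ca≢cd ∷ _) ∷ (cb≢cd ∷ _) ∷ _) =
    ⊥-elim (noThreeDistinct (c a) (c b) (c d) ca≢cb ca≢cd cb≢cd)

  rainbowConnected⇒twoStep : (c : Fin m → Fin 2) → RainbowConnected G c → TwoStepRainbow c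
  rainbowConnected⇒twoStep c rc u v u≢v =
    let (p , _ , rainbow) = rc u v in shortRainbow c p u≢v rainbow

  recolour : ∀ {k l} {c : Fin m → Fin k} (f : Fin k → Fin l) →
             (∀ {i j} → f i ≡ f j → i ≡ j) →
             RainbowConnected G c → RainbowConnected G (f ∘ c)
  recolour f f-inj rc u v =
    let (p , path , rainbow) = rc u v
    in p , path , subst Unique (sym (map-∘ (edgesOf G p))) (UniqueP.map⁺ f-inj rainbow)

colourValue : Fin 2 → ℚ
colourValue zero       = 0ℚ
colourValue (suc zero) = 1ℚ

colourValue-injective : ∀ {i j} → colourValue i ≡ colourValue j → i ≡ j
colourValue-injective {zero}     {zero}     _ = refl
colourValue-injective {suc zero} {suc zero} _ = refl
colourValue-injective {zero}     {suc zero} ()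
colourValue-injective {suc zero} {zero}     ()

colourValue-01 : ∀ i → colourValue i ≡ 0ℚ ⊎ colourValue i ≡ 1ℚ
colourValue-01 zero       = inj₁ refl
colourValue-01 (suc zero) = inj₂ refl

classOf : ℚ → ℚ → Fin 2
classOf y q with q ℚP.≟ y
... | yes _ = zero
... | no  _ = suc zero

classOf-separates : ∀ {y z p q} → (p ≡ y ⊎ p ≡ z) → (q ≡ y ⊎ q ≡ z) →
                    p ≢ q → classOf y p ≢ classOf y q
classOf-separates {y} {z} {p} {q} p∈ q∈ p≢q with p ℚP.≟ y | q ℚP.≟ y
... | yes p≡y | yes q≡y = λ _ → p≢q (trans p≡y (sym q≡y))
... | yes _   | no  _   = λ ()
... | no  _   | yes _   = λ ()
... | no p≢y  | no q≢y  = λ _ → p≢q (trans (otherValue p∈ p≢y) (sym (otherValue q∈ q≢y)))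
  where
  otherValue : ∀ {r} → r ≡ y ⊎ r ≡ z → r ≢ y → r ≡ z
  otherValue (inj₁ r≡y) r≢y = contradiction r≡y r≢y
  otherValue (inj₂ r≡z) _   = r≡z

vanishing⇒rc≥3 : ∀ {n m} (G : Graph n m) → InI[ m ,3] (fG G) → RCAtLeast G 3
vanishing⇒rc≥3 {m = m} G vanishes k k<3 c rc =
  from (fG-nonzero⇔twoStep G x) twoStep-x (vanishes x (0ℚ , 1ℚ , colourValue-01 ∘ c₂))
  where
  k≤2 : k ≤ℕ 2
  k≤2 = ℕP.≤-pred k<3
  c₂ : Fin m → Fin 2
  c₂ a = inject≤ (c a) k≤2
  x : Fin m → ℚ
  x = colourValue ∘ c₂
  twoStep-x : TwoStepRainbow G x
  twoStep-x = TwoStepRainbow-map G (_∘ colourValue-injective)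
    (rainbowConnected⇒twoStep G c₂
      (recolour G (λ i → inject≤ i k≤2) (λ {i} {j} → FinP.inject≤-injective _ _ i j) rc))

rc≥3⇒vanishing : ∀ {n m} (G : Graph n m) → RCAtLeast G 3 → InI[ m ,3] (fG G)
rc≥3⇒vanishing {m = m} G rc≥3 x (y , z , twoValued) with eval x (fG G) ℚP.≟ 0ℚ
... | yes f≡0 = f≡0
... | no  f≢0 = ⊥-elim (rc≥3 2 ℕP.≤-refl c
                   (twoStep⇒rainbowConnected G c twoStep-c))
  where
  c : Fin m → Fin 2
  c = classOf y ∘ x
  twoStep-c : TwoStepRainbow G c
  twoStep-c = TwoStepRainbow-map G (classOf-separates (twoValued _) (twoValued _))
                (to (fG-nonzero⇔twoStep G x) f≢0)

mainTheorem1 : ∀ {n m : ℕ} (G : Graph n m) → DiamAtMost2 G →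
    (InI[ m ,3] (fG G) ⇔ RCAtLeast G 3)
mainTheorem1 G _ = mk⇔ (vanishing⇒rc≥3 G) (rc≥3⇒vanishing G)
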